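{- Let $\mathbf M_1=(S,\mathcal I_1)$, $\mathbf M_2=(S,\mathcal I_2)$ be matroids, $I$ an inclusion-wise maximal common independent set, $e\in I$, and $f\in S\setminus(I\cup N^+_{D(I)}(e)\cup N^-_{D(I)}(e))$. Then $I\triangle\{e,f\}$ is dependent in at least one of $\mathbf M_1$ and $\mathbf M_2$.
   Context: $D(I)$ is the digraph on $S\cup\{s,t\}$ with arcs: $(e',f')$ for $e'\in I$, $f'\in S\setminus I$ with $I\cup\{f'\}\notin\mathcal I_1$ and $(I\cup\{f'\})\setminus\{e'\}\in\mathcal I_1$; $(f',e')$ for $e'\in I$, $f'\in S\setminus I$ with $I\cup\{f'\}\notin\mathcal I_2$ and $(I\cup\{f'\})\setminus\{e'\}\in\mathcal I_2$; $(s,f')$ for $f'\in S\setminus I$ with $I\cup\{f'\}\in\mathcal I_1$; $(f',t)$ for $f'\in S\setminus I$ with $I\cup\{f'\}\in\mathcal I_2$. $N^+_{D(I)}(e)$ and $N^-_{D(I)}(e)$ are the sets of out-neighbors and in-neighbors of $e$ in $D(I)$. -}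

module Defs where

open import Data.Nat using (ℕ; _<_)
open import Data.Bool using (_xor_)
open import Data.Fin using (Fin)
open import Data.Fin.Subset using (Subset; ⊥; ⁅_⁆; _∈_; _∉_; _⊆_; _∪_; _-_; ∣_∣)
open import Data.Vec using (zipWith)
open import Data.Product using (Σ; _×_)
open import Relation.Nullary using (¬_; Dec)
open import Level using (Level; suc; _⊔_)

infixl 5 _△_
_△_ : ∀ {n} → Subset n → Subset n → Subset n
_△_ = zipWith _xor_

-- A (finite) matroid on the ground set S = Fin n, given by its independent sets.
-- Independence is assumed decidable (an independence oracle), as for any finite matroid.
record Matroid (n : ℕ) (ℓ : Level) : Set (Level.suc ℓ) where
  field
    Indep       : Subset n → Set ℓ
    indep?      : (X : Subset n) → Dec (Indep X)
    indep-empty : Indep ⊥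
    indep-sub   : ∀ {X Y} → X ⊆ Y → Indep Y → Indep X
    indep-aug   : ∀ {X Y} → Indep X → Indep Y → ∣ X ∣ < ∣ Y ∣ →
                  Σ (Fin n) (λ y → y ∈ Y × y ∉ X × Indep (X ∪ ⁅ y ⁆))

module _ {n : ℕ} {ℓ : Level} (M₁ M₂ : Matroid n ℓ) where
  open Matroid

  CommonIndep : Subset n → Set ℓ
  CommonIndep X = Indep M₁ X × Indep M₂ X

  MaxCommonIndep : Subset n → Set ℓ
  MaxCommonIndep I = CommonIndep I × (∀ J → I ⊆ J → CommonIndep J → J ⊆ I)

  Arc₁ : Subset n → Fin n → Fin n → Set ℓ
  Arc₁ I e' f' = (e' ∈ I × f' ∉ I) × (¬ Indep M₁ (I ∪ ⁅ f' ⁆) × Indep M₁ ((I ∪ ⁅ f' ⁆) - e'))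

  Arc₂ : Subset n → Fin n → Fin n → Set ℓ
  Arc₂ I f' e' = (e' ∈ I × f' ∉ I) × (¬ Indep M₂ (I ∪ ⁅ f' ⁆) × Indep M₂ ((I ∪ ⁅ f' ⁆) - e'))

  -- the arc relation of D(I) restricted to S (arcs with s or t never touch e ∈ I's
  -- neighbourhoods among elements of S)
  ArcD : Subset n → Fin n → Fin n → Set ℓ
  ArcD I x y = Arc₁ I x y Data.Sum.⊎ Arc₂ I x y
    where import Data.Sum

{-# OPTIONS --safe #-}
module Submission where

-- If I △ {e, f} were independent in both matroids, then, as I △ {e, f} = I + f - e,
-- the absence of the arc (e, f) forces I + f to be independent in M₁ and the
-- absence of the arc (f, e) forces it to be independent in M₂; so I + f would be a
-- common independent set strictly containing I.

open import Defs
open import Level using (Level)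
open import Data.Nat using (ℕ)
open import Data.Fin using (Fin)
open import Data.Fin.Subset using (Subset; ⁅_⁆; _∈_; _∉_; _∪_; _─_; _-_; _⊆_; ∁; inside; outside)
open import Data.Fin.Subset.Properties
  using (x∈⁅x⁆; x∈⁅y⁆⇒x≡y; x∉p⇒x∈∁p; drop-∷-⊆; p⊆p∪q; x∈p∪q⁺)
open import Data.Vec using ([]; _∷_; here)
open import Data.Sum using (_⊎_; inj₁; inj₂)
open import Data.Product using (_×_; _,_)
open import Data.Empty using (⊥-elim)
open import Function using (case_of_)
open import Relation.Nullary using (¬_; yes; no)
open import Relation.Nullary.Decidable using (decidable-stable)
open import Relation.Binary.PropositionalEquality using (_≡_; refl; cong; subst; sym)

∪─≡△∪ : ∀ {n} {I E F : Subset n} → E ⊆ I → F ⊆ ∁ I → (I ∪ F) ─ E ≡ I △ (E ∪ F)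
∪─≡△∪ {I = []}          {[]}          {[]}          _   _    = refl
∪─≡△∪ {I = inside ∷ I}  {inside ∷ E}  {outside ∷ F} E⊆I F⊆∁I =
  cong (outside ∷_) (∪─≡△∪ (drop-∷-⊆ E⊆I) (drop-∷-⊆ F⊆∁I))
∪─≡△∪ {I = inside ∷ I}  {outside ∷ E} {outside ∷ F} E⊆I F⊆∁I =
  cong (inside ∷_) (∪─≡△∪ (drop-∷-⊆ E⊆I) (drop-∷-⊆ F⊆∁I))
∪─≡△∪ {I = outside ∷ I} {outside ∷ E} {outside ∷ F} E⊆I F⊆∁I =
  cong (outside ∷_) (∪─≡△∪ (drop-∷-⊆ E⊆I) (drop-∷-⊆ F⊆∁I))
∪─≡△∪ {I = outside ∷ I} {outside ∷ E} {inside ∷ F}  E⊆I F⊆∁I =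
  cong (inside ∷_) (∪─≡△∪ (drop-∷-⊆ E⊆I) (drop-∷-⊆ F⊆∁I))
∪─≡△∪ {I = inside ∷ I}  {_ ∷ E}       {inside ∷ F}  _   F⊆∁I = case F⊆∁I here of λ ()
∪─≡△∪ {I = outside ∷ I} {inside ∷ E}  {_ ∷ F}       E⊆I _    = case E⊆I here of λ ()

x∈p⇒⁅x⁆⊆p : ∀ {n} {x : Fin n} {p : Subset n} → x ∈ p → ⁅ x ⁆ ⊆ p
x∈p⇒⁅x⁆⊆p {x = x} x∈p y∈⁅x⁆ = subst (_∈ _) (sym (x∈⁅y⁆⇒x≡y x y∈⁅x⁆)) x∈p

∪⁅⁆-≡△ : ∀ {n} {I : Subset n} {e f : Fin n} → e ∈ I → f ∉ I →
         (I ∪ ⁅ f ⁆) - e ≡ I △ (⁅ e ⁆ ∪ ⁅ f ⁆)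
∪⁅⁆-≡△ e∈I f∉I = ∪─≡△∪ (x∈p⇒⁅x⁆⊆p e∈I) (x∈p⇒⁅x⁆⊆p (x∉p⇒x∈∁p f∉I))

module _ {n : ℕ} {ℓ : Level} (M : Matroid n ℓ) where
  open Matroid M

  noExchange⇒Indep-∪⁅⁆ : ∀ {I e f} → e ∈ I → f ∉ I → Indep (I △ (⁅ e ⁆ ∪ ⁅ f ⁆)) →
                         ¬ (¬ Indep (I ∪ ⁅ f ⁆) × Indep ((I ∪ ⁅ f ⁆) - e)) →
                         Indep (I ∪ ⁅ f ⁆)
  noExchange⇒Indep-∪⁅⁆ {I} {e} {f} e∈I f∉I indep noExchange =
    decidable-stable (indep? (I ∪ ⁅ f ⁆)) λ dep →
      noExchange (dep , subst Indep (sym (∪⁅⁆-≡△ e∈I f∉I)) indep)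

MaxCommonIndep⇒¬CommonIndep-∪⁅⁆ : ∀ {n ℓ} (M₁ M₂ : Matroid n ℓ) {I f} →
  MaxCommonIndep M₁ M₂ I → f ∉ I → ¬ CommonIndep M₁ M₂ (I ∪ ⁅ f ⁆)
MaxCommonIndep⇒¬CommonIndep-∪⁅⁆ M₁ M₂ {I} {f} (_ , maximal) f∉I common =
  f∉I (maximal (I ∪ ⁅ f ⁆) (p⊆p∪q _) common (x∈p∪q⁺ (inj₂ (x∈⁅x⁆ f))))

lemma7 : {n : ℕ} {ℓ : Level} (M₁ M₂ : Matroid n ℓ) (I : Subset n) →
    MaxCommonIndep M₁ M₂ I →
    (e : Fin n) → e ∈ I →
    (f : Fin n) → f ∉ I → ¬ ArcD M₁ M₂ I e f → ¬ ArcD M₁ M₂ I f e →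
    ¬ Matroid.Indep M₁ (I △ (⁅ e ⁆ ∪ ⁅ f ⁆)) ⊎ ¬ Matroid.Indep M₂ (I △ (⁅ e ⁆ ∪ ⁅ f ⁆))
lemma7 M₁ M₂ I maxI e e∈I f f∉I ¬e→f ¬f→e
  with Matroid.indep? M₁ (I △ (⁅ e ⁆ ∪ ⁅ f ⁆)) | Matroid.indep? M₂ (I △ (⁅ e ⁆ ∪ ⁅ f ⁆))
... | no dep₁  | _        = inj₁ dep₁
... | yes _    | no dep₂  = inj₂ dep₂
... | yes ind₁ | yes ind₂ = ⊥-elim (MaxCommonIndep⇒¬CommonIndep-∪⁅⁆ M₁ M₂ maxI f∉I (ext₁ , ext₂))
  where
  ext₁ : Matroid.Indep M₁ (I ∪ ⁅ f ⁆)
  ext₁ = noExchange⇒Indep-∪⁅⁆ M₁ e∈I f∉I ind₁ λ arc → ¬e→f (inj₁ ((e∈I , f∉I) , arc))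
  ext₂ : Matroid.Indep M₂ (I ∪ ⁅ f ⁆)
  ext₂ = noExchange⇒Indep-∪⁅⁆ M₂ e∈I f∉I ind₂ λ arc → ¬f→e (inj₂ ((e∈I , f∉I) , arc))
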